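{- For every positive integer $n$, as formal power series in $x$, \[ \frac{\mathrm{ODP}(\mathrm{Tour}_n,\mathrm{Cycle}_n)}{(1-x)^{n}}=n\sum_{m=0}^{\infty} m^{n-1}x^m, \] with the convention $0^0=1$.
   Context: $\mathrm{Tour}_n$ is the directed graph on $[n]$ with edge set $\{i\to j: n\ge i>j\ge 1\}$. $\mathrm{Cycle}_n$ is the directed graph on $[n]$ with edge set $\{i\to i+1:1\le i\le n-1\}\cup\{n\to 1\}$ (so $\mathrm{Cycle}_2$ has both edges $1\to2$ and $2\to1$). For directed graphs $X,Y$ on $[n]$ and a permutation $\sigma$ of $[n]$, the outdegree of $\sigma$ in the directed friends-and-seats graph $\mathrm{DFS}(X,Y)$ is the number of ordered pairs $(a,b)$ with $a\ne b$ such that $a\to b$ is an edge of $X$ and $\sigma(a)\to\sigma(b)$ is an edge of $Y$ (each such pair gives an edge from $\sigma$ to $\sigma\circ(a\;b)$). $\mathrm{ODP}(X,Y)=\sum_{\sigma\in S_n}x^{\mathrm{outdeg}(\sigma)}$. -}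

module Defs where

open import Data.Nat using (ℕ; zero; suc; _+_; _*_; _∸_; _^_; _<_; _<?_)
open import Data.Nat.Properties using () renaming (_≟_ to _≟ℕ_)
open import Data.Integer using (ℤ; +_; -_) renaming (_+_ to _+ℤ_; _*_ to _*ℤ_)
open import Data.Fin using (Fin; toℕ) renaming (_≟_ to _≟F_)
open import Data.Fin.Properties using (all?)
open import Data.Vec using (Vec; []; _∷_; lookup)
open import Data.List using (List; []; _∷_; length; filter; map; concatMap; allFin; cartesianProduct)
open import Data.Product using (_×_; _,_; proj₁; proj₂)
open import Data.Sum using (_⊎_)
open import Relation.Binary.PropositionalEquality using (_≡_; _≢_)
open import Relation.Nullary using (Dec; ¬_; ¬?; _×-dec_; _⊎-dec_; _→-dec_)

-- Directed graphs on [n], with vertex i of [n] represented by the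
-- element i-1 of Fin n.

TourE : {n : ℕ} → Fin n → Fin n → Set
TourE i j = toℕ j < toℕ i

TourE? : {n : ℕ} → (i j : Fin n) → Dec (TourE i j)
TourE? i j = toℕ j <? toℕ i

CycleE : {n : ℕ} → Fin n → Fin n → Set
CycleE {n} i j = (suc (toℕ i) ≡ toℕ j) ⊎ ((suc (toℕ i) ≡ n) × (toℕ j ≡ 0))

CycleE? : {n : ℕ} → (i j : Fin n) → Dec (CycleE i j)
CycleE? {n} i j = (suc (toℕ i) ≟ℕ toℕ j) ⊎-dec ((suc (toℕ i) ≟ℕ n) ×-dec (toℕ j ≟ℕ 0))

vecsOf : {A : Set} (k : ℕ) → List A → List (Vec A k)
vecsOf zero    xs = [] ∷ []
vecsOf (suc k) xs = concatMap (λ x → map (x ∷_) (vecsOf k xs)) xs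

IsPerm : {n : ℕ} → Vec (Fin n) n → Set
IsPerm {n} σ = (a b : Fin n) → lookup σ a ≡ lookup σ b → a ≡ b

IsPerm? : {n : ℕ} → (σ : Vec (Fin n) n) → Dec (IsPerm σ)
IsPerm? σ = all? (λ a → all? (λ b → (lookup σ a ≟F lookup σ b) →-dec (a ≟F b)))

perms : (n : ℕ) → List (Vec (Fin n) n)
perms n = filter IsPerm? (vecsOf n (allFin n))

-- Outdegree of σ in DFS(Tour_n, Cycle_n): number of ordered pairs (a,b),
-- a ≠ b, with a → b in Tour_n and σ(a) → σ(b) in Cycle_n.

Counted : {n : ℕ} → Vec (Fin n) n → Fin n × Fin n → Set
Counted σ (a , b) = (a ≢ b) × TourE a b × CycleE (lookup σ a) (lookup σ b)

Counted? : {n : ℕ} (σ : Vec (Fin n) n) (p : Fin n × Fin n) → Dec (Counted σ p)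
Counted? σ (a , b) = ¬? (a ≟F b) ×-dec TourE? a b ×-dec CycleE? (lookup σ a) (lookup σ b)

outdeg : {n : ℕ} → Vec (Fin n) n → ℕ
outdeg {n} σ = length (filter (Counted? σ) (cartesianProduct (allFin n) (allFin n)))

-- Formal power series in x with integer coefficients: ℕ → ℤ
-- (the value at m is the coefficient of x^m).

Series : Set
Series = ℕ → ℤ

sumTo : ℕ → (ℕ → ℤ) → ℤ
sumTo zero    f = f 0
sumTo (suc m) f = sumTo m f +ℤ f (suc m)

_⊛_ : Series → Series → Series
(f ⊛ g) m = sumTo m (λ i → f i *ℤ g (m ∸ i))

oneS : Series
oneS zero = + 1
oneS (suc _) = + 0

oneMinusX : Series
oneMinusX zero = + 1
oneMinusX (suc zero) = - (+ 1)
oneMinusX (suc (suc _)) = + 0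

_^S_ : Series → ℕ → Series
f ^S zero = oneS
f ^S suc k = f ⊛ (f ^S k)

-- ODP(Tour_n, Cycle_n) = Σ_σ x^{outdeg σ}, as a series:
-- coefficient of x^j is the number of permutations with outdegree j.
ODP-TourCycle : (n : ℕ) → Series
ODP-TourCycle n j = + length (filter (λ σ → outdeg σ ≟ℕ j) (perms n))

-- n Σ_{m ≥ 0} m^{n-1} x^m   (Agda's _^_ has 0 ^ 0 = 1)
rhsSeries : (n : ℕ) → Series
rhsSeries n m = + (n * m ^ (n ∸ 1))

-- outdeg σ counts the values v (mod n) whose cyclic successor v + 1 stands to the left of v in σ,
-- a cyclic inverse-descent number. Adding 1 (mod n) to every value preserves it, and every
-- permutation is uniquely such a rotation of one starting with 0, for which outdeg is
-- 1 + ides of the remaining entries. Hence ODP(Tour_n, Cycle_n) = n·x·A_{n-1}(x) for n ≥ 2, with A_k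
-- the Eulerian polynomial counting inverse descents. Writing π ∈ S_{k+1} as its first entry followed
-- by the standardised rest yields the Eulerian recurrence for A_k; the series
-- (1 - x)^{k+1} Σ m^k x^m = Δ^{k+1}(m^k) obeys the same recurrence by the Leibniz rule
-- Δ(m·g) = m·Δg + x·g, so the two agree (Worpitzky's identity).

module Submission where

open import Defs
open import Data.Nat using (ℕ; suc; _≤_)
open import Relation.Binary.PropositionalEquality using (_≡_; sym; trans)

module Combinatorics where

  open import Level using (0ℓ)
  open import Data.Bool using (true; false; if_then_else_)
  open import Data.Nat using (ℕ; zero; suc; _+_; _*_; _≤_; _<_; z≤n; s≤s; _≟_; _<?_)
  open import Data.Nat.Properties
    using ( +-0-commutativeMonoid; +-*-semiring; +-commutativeSemigroup
          ; +-assoc; +-comm; +-identityʳ; *-comm; *-identityʳ; *-zeroʳ; *-distribˡ-+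
          ; ≤-refl; ≤-reflexive; ≤-trans; ≤-antisym; +-mono-≤; *-mono-≤; n≤1+n; 1+n≰n
          ; <-irrefl; <⇒≤; <⇒≢; <⇒≱; <-≤-trans; suc-injective; module ≤-Reasoning )
  open import Algebra.Properties.CommutativeSemigroup +-commutativeSemigroup using (interchange)
  open import Algebra.Properties.CommutativeMonoid.Sum +-0-commutativeMonoid
    using (sum-syntax; sum-cong-≗; sum-replicate-zero; ∑-distrib-+; ∑-comm)
  open import Algebra.Properties.Semiring.Sum +-*-semiring using (*-distribˡ-sum; *-distribʳ-sum)
  open import Data.Fin using (Fin; zero; suc; toℕ; fromℕ; inject₁; punchIn; punchOut)
  open import Data.Fin.Properties
    using ( any?; 0≢1+n; toℕ-injective; toℕ-fromℕ; toℕ-inject₁; toℕ≤pred[n]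
          ; punchIn-injective; punchInᵢ≢i; punchIn-punchOut )
    renaming (_≟_ to _≟ᶠ_; suc-injective to Fin-suc-injective)
  open import Data.Fin.Relation.Unary.Top using (view; ‵fromℕ; ‵inj₁; view-fromℕ; view-inject₁)
  open import Data.Vec using (Vec; []; _∷_; lookup) renaming (map to mapᵥ; tabulate to tabulateᵥ)
  open import Data.Vec.Properties
    using ( ∷-injective; ∷-injectiveˡ; lookup-map; map-∘; map-cong; map-id
          ; tabulate∘lookup; tabulate-∘; tabulate-cong )
    renaming (≡-dec to ≡-decᵥ)
  open import Data.List
    using ( List; []; _∷_; _++_; map; concatMap; filter; length; tabulate; allFin
          ; cartesianProduct; cartesianProductWith )
  open import Data.List.Properties using (filter-≐; filter-none)
  open import Data.List.Membership.Propositional using (_∈_)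
  open import Data.List.Membership.Propositional.Properties
    using (∈-filter⁺; ∈-filter⁻; ∈-cartesianProductWith⁺; ∈-cartesianProductWith⁻; ∈-allFin)
  open import Data.List.Membership.Setoid.Properties using (unique⇒irrelevant)
  open import Data.List.Relation.Unary.Any using (here; there)
  import Data.List.Relation.Unary.All as All
  open import Data.List.Relation.Unary.Unique.Propositional using (Unique; []; _∷_)
  open import Data.List.Relation.Unary.Unique.Propositional.Properties
    using (cartesianProductWith⁺; allFin⁺; filter⁺)
  open import Data.List.Relation.Binary.Subset.Propositional using (_⊆_)
  open import Data.List.Relation.Binary.Permutation.Propositional using (_↭_)
  open import Data.List.Relation.Binary.Permutation.Propositional.Properties using (↭-length; filter-↭)
  open import Data.List.Relation.Binary.BagAndSetEquality using (∼bag⇒↭)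
  open import Data.Product using (_×_; _,_; ∃; ∃₂; proj₁; proj₂)
  open import Data.Sum using (inj₁; inj₂)
  open import Function using (id; _∘_; _⇔_; mk⇔; Equivalence)
  open import Function.Bundles using (mk↔ₛ′)
  open import Function.Construct.Composition using (_⇔-∘_)
  open import Function.Construct.Identity using (⇔-id)
  open import Function.Definitions using (Injective)
  open import Axiom.UniquenessOfIdentityProofs using (module Decidable⇒UIP)
  open import Relation.Nullary using (Dec; yes; no; does; ¬_; ¬?; _×-dec_)
  open import Relation.Nullary.Negation using (contradiction)
  open import Relation.Unary using (Pred; Decidable)
  open import Relation.Binary.Definitions using (DecidableEquality)
  open import Relation.Binary.PropositionalEquality
    using (_≡_; _≢_; refl; sym; trans; cong; cong₂; subst; subst₂; setoid; module ≡-Reasoning)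

  ⟦_⟧ : {P : Set} → Dec P → ℕ
  ⟦ P? ⟧ = if does P? then 1 else 0

  ⟦⟧-yes : {P : Set} (P? : Dec P) → P → ⟦ P? ⟧ ≡ 1
  ⟦⟧-yes (yes _) _ = refl
  ⟦⟧-yes (no ¬p) p = contradiction p ¬p

  ⟦⟧-no : {P : Set} (P? : Dec P) → ¬ P → ⟦ P? ⟧ ≡ 0
  ⟦⟧-no (yes p) ¬p = contradiction p ¬p
  ⟦⟧-no (no _)  _  = refl

  ⟦⟧-cong : {P Q : Set} (P? : Dec P) (Q? : Dec Q) → P ⇔ Q → ⟦ P? ⟧ ≡ ⟦ Q? ⟧
  ⟦⟧-cong (yes p) Q? P⇔Q = sym (⟦⟧-yes Q? (Equivalence.to P⇔Q p))
  ⟦⟧-cong (no ¬p) Q? P⇔Q = sym (⟦⟧-no Q? (¬p ∘ Equivalence.from P⇔Q))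

  ⟦⟧-mono : {P Q : Set} (P? : Dec P) (Q? : Dec Q) → (P → Q) → ⟦ P? ⟧ ≤ ⟦ Q? ⟧
  ⟦⟧-mono (yes p) Q? P→Q = ≤-reflexive (sym (⟦⟧-yes Q? (P→Q p)))
  ⟦⟧-mono (no _)  Q? P→Q = z≤n

  ⟦⟧-× : {P Q : Set} (P? : Dec P) (Q? : Dec Q) → ⟦ P? ×-dec Q? ⟧ ≡ ⟦ P? ⟧ * ⟦ Q? ⟧
  ⟦⟧-× (yes _) Q? = sym (+-identityʳ ⟦ Q? ⟧)
  ⟦⟧-× (no _)  Q? = refl

  ⟦⟧-split : {P Q : Set} (P? : Dec P) (Q? : Dec Q) → ⟦ P? ×-dec ¬? Q? ⟧ + ⟦ P? ×-dec Q? ⟧ ≡ ⟦ P? ⟧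
  ⟦⟧-split (yes _) (yes _) = refl
  ⟦⟧-split (yes _) (no _)  = refl
  ⟦⟧-split (no _)  _       = refl

  ⟦≟⟧-* : (a b : ℕ) → ⟦ a ≟ b ⟧ * a ≡ ⟦ a ≟ b ⟧ * b
  ⟦≟⟧-* a b with a ≟ b
  ... | yes refl = refl
  ... | no a≢b   rewrite ⟦⟧-no (a ≟ b) a≢b = refl

  module _ {A : Set} where

    listSum : List A → (A → ℕ) → ℕ
    listSum []       f = 0
    listSum (x ∷ xs) f = f x + listSum xs f

    infixl 10 listSum
    syntax listSum xs (λ x → e) = ∑[ x ∈ xs ] e

    ∑ₗ-cong : (xs : List A) {f g : A → ℕ} → (∀ {x} → x ∈ xs → f x ≡ g x) →
              ∑[ x ∈ xs ] f x ≡ ∑[ x ∈ xs ] g x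
    ∑ₗ-cong []       f≡g = refl
    ∑ₗ-cong (x ∷ xs) f≡g = cong₂ _+_ (f≡g (here refl)) (∑ₗ-cong xs (f≡g ∘ there))

    ∑ₗ-++ : (xs ys : List A) (f : A → ℕ) →
            ∑[ x ∈ xs ++ ys ] f x ≡ ∑[ x ∈ xs ] f x + ∑[ y ∈ ys ] f y
    ∑ₗ-++ []       ys f = refl
    ∑ₗ-++ (x ∷ xs) ys f = trans (cong (f x +_) (∑ₗ-++ xs ys f)) (sym (+-assoc (f x) _ _))

    ∑ₗ-distrib-+ : (xs : List A) (f g : A → ℕ) →
                   ∑[ x ∈ xs ] (f x + g x) ≡ ∑[ x ∈ xs ] f x + ∑[ x ∈ xs ] g x
    ∑ₗ-distrib-+ []       f g = refl
    ∑ₗ-distrib-+ (x ∷ xs) f g =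
      trans (cong (f x + g x +_) (∑ₗ-distrib-+ xs f g)) (interchange (f x) (g x) _ _)

    *-distribˡ-∑ₗ : (c : ℕ) (xs : List A) (f : A → ℕ) →
                    c * ∑[ x ∈ xs ] f x ≡ ∑[ x ∈ xs ] (c * f x)
    *-distribˡ-∑ₗ c []       f = *-zeroʳ c
    *-distribˡ-∑ₗ c (x ∷ xs) f =
      trans (*-distribˡ-+ c (f x) _) (cong (c * f x +_) (*-distribˡ-∑ₗ c xs f))

    length-filter≡∑ : {P : Pred A 0ℓ} (P? : Decidable P) (xs : List A) →
                      length (filter P? xs) ≡ ∑[ x ∈ xs ] ⟦ P? x ⟧
    length-filter≡∑ P? []       = refl
    length-filter≡∑ P? (x ∷ xs) with does (P? x)
    ... | true  = cong suc (length-filter≡∑ P? xs)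
    ... | false = length-filter≡∑ P? xs

  ∑ₗ-map : {A B : Set} (g : A → B) (xs : List A) (f : B → ℕ) →
           ∑[ y ∈ map g xs ] f y ≡ ∑[ x ∈ xs ] f (g x)
  ∑ₗ-map g []       f = refl
  ∑ₗ-map g (x ∷ xs) f = cong (f (g x) +_) (∑ₗ-map g xs f)

  ∑ₗ-cartesianProductWith : {A B C : Set} (g : A → B → C) (xs : List A) (ys : List B) (f : C → ℕ) →
    ∑[ z ∈ cartesianProductWith g xs ys ] f z ≡ ∑[ x ∈ xs ] ∑[ y ∈ ys ] f (g x y)
  ∑ₗ-cartesianProductWith g []       ys f = refl
  ∑ₗ-cartesianProductWith g (x ∷ xs) ys f = begin
    ∑[ z ∈ map (g x) ys ++ cartesianProductWith g xs ys ] f z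
      ≡⟨ ∑ₗ-++ (map (g x) ys) _ f ⟩
    ∑[ z ∈ map (g x) ys ] f z + ∑[ z ∈ cartesianProductWith g xs ys ] f z
      ≡⟨ cong₂ _+_ (∑ₗ-map (g x) ys f) (∑ₗ-cartesianProductWith g xs ys f) ⟩
    ∑[ y ∈ ys ] f (g x y) + ∑[ x ∈ xs ] ∑[ y ∈ ys ] f (g x y)
      ∎
    where open ≡-Reasoning

  ∑ₗ-tabulate : {A : Set} (n : ℕ) (g : Fin n → A) (f : A → ℕ) →
                ∑[ x ∈ tabulate g ] f x ≡ ∑[ i < n ] f (g i)
  ∑ₗ-tabulate zero    g f = refl
  ∑ₗ-tabulate (suc n) g f = cong (f (g zero) +_) (∑ₗ-tabulate n (g ∘ suc) f)

  ∑ₗ-allFin : (n : ℕ) (f : Fin n → ℕ) → ∑[ i ∈ allFin n ] f i ≡ ∑[ i < n ] f i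
  ∑ₗ-allFin n = ∑ₗ-tabulate n id

  ∑-const : (n c : ℕ) → ∑[ i < n ] c ≡ n * c
  ∑-const zero    c = refl
  ∑-const (suc n) c = cong (c +_) (∑-const n c)

  ∑-mono-≤ : (n : ℕ) {f g : Fin n → ℕ} → (∀ i → f i ≤ g i) → ∑[ i < n ] f i ≤ ∑[ i < n ] g i
  ∑-mono-≤ zero    f≤g = z≤n
  ∑-mono-≤ (suc n) f≤g = +-mono-≤ (f≤g zero) (∑-mono-≤ n (f≤g ∘ suc))

  ∑-⟦≟⟧ : {n : ℕ} (j : Fin n) → ∑[ i < n ] ⟦ i ≟ᶠ j ⟧ ≡ 1
  ∑-⟦≟⟧ {suc n} zero    = cong suc (sum-replicate-zero n)
  ∑-⟦≟⟧ {suc n} (suc j) = ∑-⟦≟⟧ j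

  module _ {n : ℕ} {P : Pred (Fin n) 0ℓ} (P? : Decidable P) (unique : ∀ {i j} → P i → P j → i ≡ j) where

    ∑-unique : {j : Fin n} → P j → ∑[ i < n ] ⟦ P? i ⟧ ≡ 1
    ∑-unique {j} pj = trans (sum-cong-≗ P≐≡j) (∑-⟦≟⟧ j)
      where
      P≐≡j : ∀ i → ⟦ P? i ⟧ ≡ ⟦ i ≟ᶠ j ⟧
      P≐≡j i = ⟦⟧-cong (P? i) (i ≟ᶠ j) (mk⇔ (λ pi → unique pi pj) (λ { refl → pj }))

    ∑-atMostOne : ∑[ i < n ] ⟦ P? i ⟧ ≤ 1
    ∑-atMostOne with any? P?
    ... | yes (j , pj) = ≤-reflexive (∑-unique pj)
    ... | no ∄P = ≤-trans (≤-reflexive (trans (sum-cong-≗ none) (sum-replicate-zero n))) z≤n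
      where
      none : ∀ i → ⟦ P? i ⟧ ≡ 0
      none i = ⟦⟧-no (P? i) (λ pi → ∄P (i , pi))

  ∑∑-distrib-+ : {m n : ℕ} (f g : Fin m → Fin n → ℕ) →
    ∑[ a < m ] ∑[ b < n ] (f a b + g a b) ≡ ∑[ a < m ] ∑[ b < n ] f a b + ∑[ a < m ] ∑[ b < n ] g a b
  ∑∑-distrib-+ {m} {n} f g = trans (sum-cong-≗ (λ a → ∑-distrib-+ (f a) (g a)))
    (∑-distrib-+ (λ a → ∑[ b < n ] f a b) (λ a → ∑[ b < n ] g a b))

  ∑∑-dropRow₀ : {n : ℕ} (f : Fin (suc n) → Fin (suc n) → ℕ) → (∀ b → f zero b ≡ 0) →
    ∑[ a < suc n ] ∑[ b < suc n ] f a b ≡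
    ∑[ a < n ] f (suc a) zero + ∑[ a < n ] ∑[ b < n ] f (suc a) (suc b)
  ∑∑-dropRow₀ {n} f row₀≡0 =
    trans (cong (_+ ∑[ a < n ] (f (suc a) zero + ∑[ b < n ] f (suc a) (suc b)))
                (trans (sum-cong-≗ row₀≡0) (sum-replicate-zero (suc n))))
          (∑-distrib-+ (λ a → f (suc a) zero) (λ a → ∑[ b < n ] f (suc a) (suc b)))

  -- f takes the value s where ε is 1 and 1 + s where ε is 0; the number of i with f i = d is
  -- stated with both sides moved so that no subtraction occurs.
  ∑-levelSets : {n : ℕ} (f ε : Fin n → ℕ) (s d : ℕ) →
    (∀ i → ε i ≤ 1) → (∀ i → f i + ε i ≡ suc s) →
    ∑[ i < n ] ⟦ f i ≟ d ⟧ + ⟦ suc s ≟ d ⟧ * ∑[ i < n ] ε i ≡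
    ⟦ s ≟ d ⟧ * ∑[ i < n ] ε i + ⟦ suc s ≟ d ⟧ * n
  ∑-levelSets {n} f ε s d ε≤1 f+ε≡1+s = begin
    ∑[ i < n ] ⟦ f i ≟ d ⟧ + ⟦ suc s ≟ d ⟧ * ∑[ i < n ] ε i
      ≡⟨ cong (∑[ i < n ] ⟦ f i ≟ d ⟧ +_) (*-distribˡ-sum ⟦ suc s ≟ d ⟧ ε) ⟩
    ∑[ i < n ] ⟦ f i ≟ d ⟧ + ∑[ i < n ] (⟦ suc s ≟ d ⟧ * ε i)
      ≡⟨ ∑-distrib-+ (λ i → ⟦ f i ≟ d ⟧) (λ i → ⟦ suc s ≟ d ⟧ * ε i) ⟨
    ∑[ i < n ] (⟦ f i ≟ d ⟧ + ⟦ suc s ≟ d ⟧ * ε i)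
      ≡⟨ sum-cong-≗ (λ i → levelSet (f i) (ε i) (ε≤1 i) (f+ε≡1+s i)) ⟩
    ∑[ i < n ] (⟦ s ≟ d ⟧ * ε i + ⟦ suc s ≟ d ⟧)
      ≡⟨ ∑-distrib-+ (λ i → ⟦ s ≟ d ⟧ * ε i) (λ _ → ⟦ suc s ≟ d ⟧) ⟩
    ∑[ i < n ] (⟦ s ≟ d ⟧ * ε i) + ∑[ i < n ] ⟦ suc s ≟ d ⟧
      ≡⟨ cong₂ _+_ (sym (*-distribˡ-sum ⟦ s ≟ d ⟧ ε)) (trans (∑-const n _) (*-comm n _)) ⟩
    ⟦ s ≟ d ⟧ * ∑[ i < n ] ε i + ⟦ suc s ≟ d ⟧ * n
      ∎
    where
    open ≡-Reasoning
    levelSet : (fᵢ e : ℕ) → e ≤ 1 → fᵢ + e ≡ suc s →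
               ⟦ fᵢ ≟ d ⟧ + ⟦ suc s ≟ d ⟧ * e ≡ ⟦ s ≟ d ⟧ * e + ⟦ suc s ≟ d ⟧
    levelSet fᵢ zero _ fᵢ+0≡1+s
      rewrite +-identityʳ fᵢ | fᵢ+0≡1+s | *-zeroʳ ⟦ suc s ≟ d ⟧ | *-zeroʳ ⟦ s ≟ d ⟧ = +-identityʳ _
    levelSet fᵢ (suc zero) _ fᵢ+1≡1+s
      rewrite suc-injective (trans (+-comm 1 fᵢ) fᵢ+1≡1+s)
            | *-identityʳ ⟦ suc s ≟ d ⟧ | *-identityʳ ⟦ s ≟ d ⟧ = refl
    levelSet fᵢ (suc (suc _)) (s≤s ()) _

  -- Enumerating permutations

  -- Membership in a duplicate-free list is proof-irrelevant, so mutual inclusion is a bag equality.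
  unique-⊆⊇⇒↭ : {A : Set} → DecidableEquality A → {xs ys : List A} →
                Unique xs → Unique ys → xs ⊆ ys → ys ⊆ xs → xs ↭ ys
  unique-⊆⊇⇒↭ {A} _≟ᴬ_ xs! ys! xs⊆ys ys⊆xs =
    ∼bag⇒↭ (mk↔ₛ′ xs⊆ys ys⊆xs (λ _ → irrelevant ys! _ _) (λ _ → irrelevant xs! _ _))
    where irrelevant = unique⇒irrelevant (setoid A) (Decidable⇒UIP.≡-irrelevant _≟ᴬ_)

  module _ {A : Set} where

    vecsOf-suc : (k : ℕ) (xs : List A) → vecsOf (suc k) xs ≡ cartesianProductWith _∷_ xs (vecsOf k xs)
    vecsOf-suc k xs = go xs
      where
      go : (ys : List A) →
           concatMap (λ y → map (y ∷_) (vecsOf k xs)) ys ≡ cartesianProductWith _∷_ ys (vecsOf k xs)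
      go []       = refl
      go (y ∷ ys) = cong (map (y ∷_) (vecsOf k xs) ++_) (go ys)

    vecsOf⁺ : (k : ℕ) {xs : List A} → Unique xs → Unique (vecsOf k xs)
    vecsOf⁺ zero    xs! = All.[] ∷ []
    vecsOf⁺ (suc k) {xs} xs! rewrite vecsOf-suc k xs =
      cartesianProductWith⁺ _∷_ ∷-injective xs! (vecsOf⁺ k xs!)

  ∈-vecsOf-allFin : {n k : ℕ} (v : Vec (Fin n) k) → v ∈ vecsOf k (allFin n)
  ∈-vecsOf-allFin []                = here refl
  ∈-vecsOf-allFin {n} {suc k} (x ∷ v) rewrite vecsOf-suc k (allFin n) =
    ∈-cartesianProductWith⁺ _∷_ (∈-allFin x) (∈-vecsOf-allFin v)

  perms⁺ : (n : ℕ) → Unique (perms n)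
  perms⁺ n = filter⁺ IsPerm? (vecsOf⁺ n (allFin⁺ n))

  ∈-perms⁺ : {n : ℕ} {σ : Vec (Fin n) n} → IsPerm σ → σ ∈ perms n
  ∈-perms⁺ {σ = σ} σ-perm = ∈-filter⁺ IsPerm? (∈-vecsOf-allFin σ) σ-perm

  ∈-perms⁻ : {n : ℕ} {σ : Vec (Fin n) n} → σ ∈ perms n → IsPerm σ
  ∈-perms⁻ {n} σ∈perms = proj₂ (∈-filter⁻ IsPerm? {xs = vecsOf n (allFin n)} σ∈perms)

  record IsPermBijection {k : ℕ} (f : Vec (Fin k) k → Fin (suc k) → Vec (Fin (suc k)) (suc k)) : Set where
    field
      injective  : ∀ {π ρ x y} → f π x ≡ f ρ y → π ≡ ρ × x ≡ y
      isPerm     : ∀ {π} x → IsPerm π → IsPerm (f π x)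
      surjective : ∀ {σ} → IsPerm σ → ∃₂ λ π x → IsPerm π × f π x ≡ σ

  module _ {k : ℕ} {f : Vec (Fin k) k → Fin (suc k) → Vec (Fin (suc k)) (suc k)}
           (f-bij : IsPermBijection f) where

    open IsPermBijection f-bij

    perms-suc↭ : perms (suc k) ↭ cartesianProductWith f (perms k) (allFin (suc k))
    perms-suc↭ = unique-⊆⊇⇒↭ (≡-decᵥ _≟ᶠ_) (perms⁺ (suc k))
      (cartesianProductWith⁺ f injective (perms⁺ k) (allFin⁺ (suc k))) perms⊆image image⊆perms
      where
      perms⊆image : perms (suc k) ⊆ cartesianProductWith f (perms k) (allFin (suc k))
      perms⊆image {σ} σ∈perms with π , x , π-perm , refl ← surjective {σ} (∈-perms⁻ σ∈perms) =
        ∈-cartesianProductWith⁺ f (∈-perms⁺ π-perm) (∈-allFin x)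
      image⊆perms : cartesianProductWith f (perms k) (allFin (suc k)) ⊆ perms (suc k)
      image⊆perms σ∈image
        with π , x , π∈perms , _ , refl ← ∈-cartesianProductWith⁻ f (perms k) (allFin (suc k)) σ∈image =
        ∈-perms⁺ (isPerm x (∈-perms⁻ π∈perms))

    count-perms-suc : {P : Pred (Vec (Fin (suc k)) (suc k)) 0ℓ} (P? : Decidable P) →
      length (filter P? (perms (suc k))) ≡ ∑[ π ∈ perms k ] ∑[ x < suc k ] ⟦ P? (f π x) ⟧
    count-perms-suc P? = begin
      length (filter P? (perms (suc k)))
        ≡⟨ ↭-length (filter-↭ P? perms-suc↭) ⟩
      length (filter P? image)
        ≡⟨ length-filter≡∑ P? image ⟩
      ∑[ σ ∈ image ] ⟦ P? σ ⟧
        ≡⟨ ∑ₗ-cartesianProductWith f (perms k) (allFin (suc k)) _ ⟩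
      ∑[ π ∈ perms k ] ∑[ x ∈ allFin (suc k) ] ⟦ P? (f π x) ⟧
        ≡⟨ ∑ₗ-cong (perms k) (λ {π} _ → ∑ₗ-allFin (suc k) (λ x → ⟦ P? (f π x) ⟧)) ⟩
      ∑[ π ∈ perms k ] ∑[ x < suc k ] ⟦ P? (f π x) ⟧
        ∎
      where
      open ≡-Reasoning
      image = cartesianProductWith f (perms k) (allFin (suc k))

  prepend : {k : ℕ} → Vec (Fin k) k → Fin (suc k) → Vec (Fin (suc k)) (suc k)
  prepend π x = x ∷ mapᵥ (punchIn x) π

  lookup-prepend : {k : ℕ} (π : Vec (Fin k) k) (x : Fin (suc k)) (a : Fin k) →
                   lookup (prepend π x) (suc a) ≡ punchIn x (lookup π a)
  lookup-prepend π x a = lookup-map a (punchIn x) π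

  mapᵥ-injective : {A B : Set} {n : ℕ} {f : A → B} →
                   Injective _≡_ _≡_ f → Injective _≡_ _≡_ (mapᵥ {n = n} f)
  mapᵥ-injective f-inj {[]}    {[]}    _  = refl
  mapᵥ-injective f-inj {x ∷ u} {y ∷ v} eq with fx≡fy , eq′ ← ∷-injective eq =
    cong₂ _∷_ (f-inj fx≡fy) (mapᵥ-injective f-inj eq′)

  mapᵥ-isPerm : {n : ℕ} {g : Fin n → Fin n} → Injective _≡_ _≡_ g →
                (σ : Vec (Fin n) n) → IsPerm σ → IsPerm (mapᵥ g σ)
  mapᵥ-isPerm {g = g} g-inj σ σ-perm a b eq =
    σ-perm a b (g-inj (trans (sym (lookup-map a g σ)) (trans eq (lookup-map b g σ))))

  module _ {k : ℕ} where

    prepend-injective : {π ρ : Vec (Fin k) k} {x y : Fin (suc k)} →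
                        prepend π x ≡ prepend ρ y → π ≡ ρ × x ≡ y
    prepend-injective {x = x} eq with refl , eq′ ← ∷-injective eq =
      mapᵥ-injective (punchIn-injective x _ _) eq′ , refl

    prepend-isPerm : {π : Vec (Fin k) k} (x : Fin (suc k)) → IsPerm π → IsPerm (prepend π x)
    prepend-isPerm         x π-perm zero    zero    _  = refl
    prepend-isPerm {π = π} x π-perm zero    (suc b) eq =
      contradiction (sym (trans eq (lookup-prepend π x b))) (punchInᵢ≢i x (lookup π b))
    prepend-isPerm {π = π} x π-perm (suc a) zero    eq =
      contradiction (trans (sym (lookup-prepend π x a)) eq) (punchInᵢ≢i x (lookup π a))
    prepend-isPerm {π = π} x π-perm (suc a) (suc b) eq = cong suc (π-perm a b (punchIn-injective x _ _
      (trans (sym (lookup-prepend π x a)) (trans eq (lookup-prepend π x b)))))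

    isPerm-prepend⁻ : {π : Vec (Fin k) k} {x : Fin (suc k)} → IsPerm (prepend π x) → IsPerm π
    isPerm-prepend⁻ {π} {x} σ-perm a b eq = Fin-suc-injective (σ-perm (suc a) (suc b)
      (trans (lookup-prepend π x a) (trans (cong (punchIn x) eq) (sym (lookup-prepend π x b)))))

    prepend-surjective : {σ : Vec (Fin (suc k)) (suc k)} → IsPerm σ →
                         ∃₂ λ π x → IsPerm π × prepend π x ≡ σ
    prepend-surjective {x ∷ τ} σ-perm =
      π , x , isPerm-prepend⁻ (subst IsPerm (sym prepend≡σ) σ-perm) , prepend≡σ
      where
      x≢τ : ∀ a → x ≢ lookup τ a
      x≢τ a eq = 0≢1+n (σ-perm zero (suc a) eq)
      π : Vec (Fin k) k
      π = tabulateᵥ (λ a → punchOut (x≢τ a))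
      open ≡-Reasoning
      prepend≡σ : prepend π x ≡ x ∷ τ
      prepend≡σ = cong (x ∷_) (begin
        mapᵥ (punchIn x) (tabulateᵥ (λ a → punchOut (x≢τ a)))
          ≡⟨ tabulate-∘ (punchIn x) _ ⟨
        tabulateᵥ (λ a → punchIn x (punchOut (x≢τ a)))
          ≡⟨ tabulate-cong (λ a → punchIn-punchOut (x≢τ a)) ⟩
        tabulateᵥ (lookup τ)
          ≡⟨ tabulate∘lookup τ ⟩
        τ
          ∎)

    prepend-isPermBijection : IsPermBijection (prepend {k})
    prepend-isPermBijection = record
      { injective  = prepend-injective
      ; isPerm     = prepend-isPerm
      ; surjective = prepend-surjective
      }

  isPerm⇒surjective : {k : ℕ} (π : Vec (Fin k) k) → IsPerm π → (v : Fin k) → ∃ λ a → lookup π a ≡ v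
  isPerm⇒surjective {suc k} π π-perm v with ρ , x , ρ-perm , refl ← prepend-surjective {σ = π} π-perm
    with v ≟ᶠ x
  ... | yes refl = zero , refl
  ... | no v≢x with a , ρa≡v′ ← isPerm⇒surjective ρ ρ-perm (punchOut (v≢x ∘ sym)) =
    suc a , trans (lookup-prepend ρ x a) (trans (cong (punchIn x) ρa≡v′) (punchIn-punchOut _))

  outdeg≡∑∑ : {n : ℕ} (σ : Vec (Fin n) n) → outdeg σ ≡ ∑[ a < n ] ∑[ b < n ] ⟦ Counted? σ (a , b) ⟧
  outdeg≡∑∑ {n} σ = begin
    length (filter (Counted? σ) (cartesianProduct (allFin n) (allFin n)))
      ≡⟨ length-filter≡∑ (Counted? σ) (cartesianProduct (allFin n) (allFin n)) ⟩
    ∑[ p ∈ cartesianProduct (allFin n) (allFin n) ] ⟦ Counted? σ p ⟧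
      ≡⟨ ∑ₗ-cartesianProductWith _,_ (allFin n) (allFin n) _ ⟩
    ∑[ a ∈ allFin n ] ∑[ b ∈ allFin n ] ⟦ Counted? σ (a , b) ⟧
      ≡⟨ ∑ₗ-cong (allFin n) (λ {a} _ → ∑ₗ-allFin n (λ b → ⟦ Counted? σ (a , b) ⟧)) ⟩
    ∑[ a ∈ allFin n ] ∑[ b < n ] ⟦ Counted? σ (a , b) ⟧
      ≡⟨ ∑ₗ-allFin n _ ⟩
    ∑[ a < n ] ∑[ b < n ] ⟦ Counted? σ (a , b) ⟧
      ∎
    where open ≡-Reasoning

  outdeg-mapᵥ : {n : ℕ} {g : Fin n → Fin n} → (∀ u v → CycleE (g u) (g v) ⇔ CycleE u v) →
                (σ : Vec (Fin n) n) → outdeg (mapᵥ g σ) ≡ outdeg σ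
  outdeg-mapᵥ {n} {g} g-resp σ =
    cong length (filter-≐ (Counted? (mapᵥ g σ)) (Counted? σ) (to , from) (cartesianProduct (allFin n) (allFin n)))
    where
    to : ∀ {p} → Counted (mapᵥ g σ) p → Counted σ p
    to {a , b} (a≢b , b<a , c) = a≢b , b<a ,
      Equivalence.to (g-resp _ _) (subst₂ CycleE (lookup-map a g σ) (lookup-map b g σ) c)
    from : ∀ {p} → Counted σ p → Counted (mapᵥ g σ) p
    from {a , b} (a≢b , b<a , c) = a≢b , b<a ,
      subst₂ CycleE (sym (lookup-map a g σ)) (sym (lookup-map b g σ)) (Equivalence.from (g-resp _ _) c)

  -- Rotating values cyclically

  module Rotation {m : ℕ} where

    prev : Fin (suc m) → Fin (suc m)
    prev zero    = fromℕ m
    prev (suc i) = inject₁ i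

    next : Fin (suc m) → Fin (suc m)
    next i with view i
    ... | ‵fromℕ          = zero
    ... | ‵inj₁ {i = j} _ = suc j

    next-prev : ∀ i → next (prev i) ≡ i
    next-prev zero    rewrite view-fromℕ m   = refl
    next-prev (suc i) rewrite view-inject₁ i = refl

    prev-next : ∀ i → prev (next i) ≡ i
    prev-next i with view i
    ... | ‵fromℕ  = refl
    ... | ‵inj₁ _ = refl

    toℕ-next : ∀ i → toℕ i < m → toℕ (next i) ≡ suc (toℕ i)
    toℕ-next i i<m with view i
    ... | ‵fromℕ          = contradiction (subst (_< m) (toℕ-fromℕ m) i<m) (<-irrefl refl)
    ... | ‵inj₁ {i = j} _ = cong suc (sym (toℕ-inject₁ j))

    CycleE⇔≡prev : (u v : Fin (suc m)) → CycleE u v ⇔ u ≡ prev v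
    CycleE⇔≡prev u zero = mk⇔ to from
      where
      to : CycleE u zero → u ≡ fromℕ m
      to (inj₂ (1+u≡1+m , _)) = toℕ-injective (trans (suc-injective 1+u≡1+m) (sym (toℕ-fromℕ m)))
      from : u ≡ fromℕ m → CycleE u zero
      from refl = inj₂ (cong suc (toℕ-fromℕ m) , refl)
    CycleE⇔≡prev u (suc v) = mk⇔ to from
      where
      to : CycleE u (suc v) → u ≡ inject₁ v
      to (inj₁ 1+u≡1+v) = toℕ-injective (trans (suc-injective 1+u≡1+v) (sym (toℕ-inject₁ v)))
      from : u ≡ inject₁ v → CycleE u (suc v)
      from refl = inj₁ (cong suc (toℕ-inject₁ v))

    CycleE-next : ∀ u v → CycleE (next u) (next v) ⇔ CycleE u v
    CycleE-next u v = mk⇔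
      (λ c → from (CycleE⇔≡prev u v) (trans (sym (prev-next u))
        (cong prev (trans (to (CycleE⇔≡prev (next u) (next v)) c) (prev-next v)))))
      (λ c → from (CycleE⇔≡prev (next u) (next v))
        (trans (trans (cong next (to (CycleE⇔≡prev u v) c)) (next-prev v)) (sym (prev-next v))))
      where open Equivalence

    rotate : ℕ → Fin (suc m) → Fin (suc m)
    rotate zero    = id
    rotate (suc t) = next ∘ rotate t

    unrotate : ℕ → Fin (suc m) → Fin (suc m)
    unrotate zero    = id
    unrotate (suc t) = unrotate t ∘ prev

    rotate-unrotate : ∀ t i → rotate t (unrotate t i) ≡ i
    rotate-unrotate zero    i = refl
    rotate-unrotate (suc t) i = trans (cong next (rotate-unrotate t (prev i))) (next-prev i)

    unrotate-rotate : ∀ t i → unrotate t (rotate t i) ≡ i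
    unrotate-rotate zero    i = refl
    unrotate-rotate (suc t) i = trans (cong (unrotate t) (prev-next (rotate t i))) (unrotate-rotate t i)

    rotate-injective : ∀ t → Injective _≡_ _≡_ (rotate t)
    rotate-injective t {i} {j} eq =
      trans (sym (unrotate-rotate t i)) (trans (cong (unrotate t) eq) (unrotate-rotate t j))

    unrotate-injective : ∀ t → Injective _≡_ _≡_ (unrotate t)
    unrotate-injective t {i} {j} eq =
      trans (sym (rotate-unrotate t i)) (trans (cong (rotate t) eq) (rotate-unrotate t j))

    CycleE-rotate : ∀ t u v → CycleE (rotate t u) (rotate t v) ⇔ CycleE u v
    CycleE-rotate zero    u v = ⇔-id _
    CycleE-rotate (suc t) u v = CycleE-rotate t u v ⇔-∘ CycleE-next (rotate t u) (rotate t v)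

    toℕ-rotate-zero : ∀ t → t ≤ m → toℕ (rotate t zero) ≡ t
    toℕ-rotate-zero zero    _   = refl
    toℕ-rotate-zero (suc t) t<m = trans (toℕ-next _ (subst (_< m) (sym IH) t<m)) (cong suc IH)
      where IH = toℕ-rotate-zero t (<⇒≤ t<m)

    rotate-toℕ-zero : ∀ r → rotate (toℕ r) zero ≡ r
    rotate-toℕ-zero r = toℕ-injective (toℕ-rotate-zero (toℕ r) (toℕ≤pred[n] r))

    rotated : Vec (Fin m) m → Fin (suc m) → Vec (Fin (suc m)) (suc m)
    rotated π r = mapᵥ (rotate (toℕ r)) (prepend π zero)

    rotated-injective : ∀ {π ρ r s} → rotated π r ≡ rotated ρ s → π ≡ ρ × r ≡ s
    rotated-injective {r = r} {s} eq
      with refl ← trans (sym (rotate-toℕ-zero r)) (trans (∷-injectiveˡ eq) (rotate-toℕ-zero s)) =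
      proj₁ (prepend-injective (mapᵥ-injective (rotate-injective (toℕ r)) eq)) , refl

    rotated-surjective : {σ : Vec (Fin (suc m)) (suc m)} → IsPerm σ →
                         ∃₂ λ π r → IsPerm π × rotated π r ≡ σ
    rotated-surjective {σ@(r ∷ _)} σ-perm =
      unrotated (prepend-surjective (mapᵥ-isPerm (unrotate-injective t) σ σ-perm))
      where
      t = toℕ r
      open ≡-Reasoning
      unrotated : (∃₂ λ π x → IsPerm π × prepend π x ≡ mapᵥ (unrotate t) σ) →
                  ∃₂ λ π s → IsPerm π × rotated π s ≡ σ
      unrotated (π , x , π-perm , prepend≡τ) = π , r , π-perm , (begin
        mapᵥ (rotate t) (prepend π zero)       ≡⟨ cong (mapᵥ (rotate t) ∘ prepend π) x≡0 ⟨
        mapᵥ (rotate t) (prepend π x)          ≡⟨ cong (mapᵥ (rotate t)) prepend≡τ ⟩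
        mapᵥ (rotate t) (mapᵥ (unrotate t) σ)  ≡⟨ map-∘ (rotate t) (unrotate t) σ ⟨
        mapᵥ (rotate t ∘ unrotate t) σ         ≡⟨ map-cong (rotate-unrotate t) σ ⟩
        mapᵥ id σ                              ≡⟨ map-id σ ⟩
        σ                                      ∎)
        where
        x≡0 : x ≡ zero
        x≡0 = begin
          x                          ≡⟨ ∷-injectiveˡ prepend≡τ ⟩
          unrotate t r               ≡⟨ cong (unrotate t) (rotate-toℕ-zero r) ⟨
          unrotate t (rotate t zero) ≡⟨ unrotate-rotate t zero ⟩
          zero                       ∎

    rotated-isPermBijection : IsPermBijection rotated
    rotated-isPermBijection = record
      { injective  = rotated-injective
      ; isPerm     = λ {π} r π-perm →
                       mapᵥ-isPerm (rotate-injective (toℕ r)) (prepend π zero) (prepend-isPerm zero π-perm)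
      ; surjective = rotated-surjective
      }

    outdeg-rotated : (π : Vec (Fin m) m) (r : Fin (suc m)) → outdeg (rotated π r) ≡ outdeg (prepend π zero)
    outdeg-rotated π r = outdeg-mapᵥ (CycleE-rotate (toℕ r)) (prepend π zero)

  -- Inverse descents and the Eulerian recurrence

  InvDescent : {k : ℕ} → Vec (Fin k) k → Fin k → Fin k → Set
  InvDescent π a b = toℕ b < toℕ a × suc (toℕ (lookup π a)) ≡ toℕ (lookup π b)

  invDescent? : {k : ℕ} (π : Vec (Fin k) k) (a b : Fin k) → Dec (InvDescent π a b)
  invDescent? π a b = (toℕ b <? toℕ a) ×-dec (suc (toℕ (lookup π a)) ≟ toℕ (lookup π b))

  ides : {k : ℕ} → Vec (Fin k) k → ℕ
  ides {k} π = ∑[ a < k ] ∑[ b < k ] ⟦ invDescent? π a b ⟧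

  idesAt : {k : ℕ} → Vec (Fin k) k → Fin (suc k) → ℕ
  idesAt {k} π x = ∑[ a < k ] ∑[ b < k ] ⟦ invDescent? π a b ×-dec (toℕ (lookup π b) ≟ toℕ x) ⟧

  outdeg-prepend-zero : {k : ℕ} (π : Vec (Fin k) k) →
    outdeg (prepend π zero) ≡ ∑[ a < k ] ⟦ suc (toℕ (lookup π a)) ≟ k ⟧ + ides π
  outdeg-prepend-zero {k} π =
    trans (outdeg≡∑∑ σ) (trans (∑∑-dropRow₀ (λ a b → ⟦ Counted? σ (a , b) ⟧) row₀)
      (cong₂ _+_ (sum-cong-≗ column₀) (sum-cong-≗ (λ a → sum-cong-≗ (inner a)))))
    where
    σ = prepend π zero
    row₀ : ∀ b → ⟦ Counted? σ (zero , b) ⟧ ≡ 0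
    row₀ b = ⟦⟧-no (Counted? σ (zero , b)) (λ { (_ , () , _) })
    column₀ : ∀ a → ⟦ Counted? σ (suc a , zero) ⟧ ≡ ⟦ suc (toℕ (lookup π a)) ≟ k ⟧
    column₀ a = ⟦⟧-cong (Counted? σ (suc a , zero)) (suc (toℕ (lookup π a)) ≟ k) (mk⇔ to from)
      where
      to : Counted σ (suc a , zero) → suc (toℕ (lookup π a)) ≡ k
      to (_ , _ , c) with subst (λ w → CycleE w zero) (lookup-prepend π zero a) c
      ... | inj₂ (2+πa≡1+k , _) = suc-injective 2+πa≡1+k
      from : suc (toℕ (lookup π a)) ≡ k → Counted σ (suc a , zero)
      from 1+πa≡k = (λ ()) , s≤s z≤n ,
        subst (λ w → CycleE w zero) (sym (lookup-prepend π zero a)) (inj₂ (cong suc 1+πa≡k , refl))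
    inner : ∀ a b → ⟦ Counted? σ (suc a , suc b) ⟧ ≡ ⟦ invDescent? π a b ⟧
    inner a b = ⟦⟧-cong (Counted? σ (suc a , suc b)) (invDescent? π a b) (mk⇔ to from)
      where
      to : Counted σ (suc a , suc b) → InvDescent π a b
      to (_ , s≤s b<a , c) with subst₂ CycleE (lookup-prepend π zero a) (lookup-prepend π zero b) c
      ... | inj₁ 2+πa≡1+πb = b<a , suc-injective 2+πa≡1+πb
      from : InvDescent π a b → Counted σ (suc a , suc b)
      from (b<a , 1+πa≡πb) =
        (λ a≡b → <-irrefl (cong toℕ (sym (Fin-suc-injective a≡b))) b<a) , s≤s b<a ,
        subst₂ CycleE (sym (lookup-prepend π zero a)) (sym (lookup-prepend π zero b)) (inj₁ (cong suc 1+πa≡πb))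

  ∑-⟦lookup≟⟧ : {k : ℕ} (π : Vec (Fin k) k) → IsPerm π → (y : Fin k) →
                ∑[ a < k ] ⟦ toℕ (lookup π a) ≟ toℕ y ⟧ ≡ 1
  ∑-⟦lookup≟⟧ π π-perm y = ∑-unique (λ a → toℕ (lookup π a) ≟ toℕ y)
    (λ πa≡y πb≡y → π-perm _ _ (toℕ-injective (trans πa≡y (sym πb≡y))))
    (cong toℕ (proj₂ (isPerm⇒surjective π π-perm y)))

  outdeg-prepend-zero-isPerm : {k : ℕ} (π : Vec (Fin (suc k)) (suc k)) → IsPerm π →
                               outdeg (prepend π zero) ≡ suc (ides π)
  outdeg-prepend-zero-isPerm {k} π π-perm = trans (outdeg-prepend-zero π) (cong (_+ ides π) (begin
    ∑[ a < suc k ] ⟦ toℕ (lookup π a) ≟ k ⟧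
      ≡⟨ sum-cong-≗ (λ a → cong (λ v → ⟦ toℕ (lookup π a) ≟ v ⟧) (toℕ-fromℕ k)) ⟨
    ∑[ a < suc k ] ⟦ toℕ (lookup π a) ≟ toℕ (fromℕ k) ⟧
      ≡⟨ ∑-⟦lookup≟⟧ π π-perm (fromℕ k) ⟩
    1
      ∎))
    where open ≡-Reasoning

  data PunchedIn (x u : ℕ) : ℕ → Set where
    below : u < x → PunchedIn x u u
    above : x ≤ u → PunchedIn x u (suc u)

  punchIn-view : {k : ℕ} (x : Fin (suc k)) (u : Fin k) → PunchedIn (toℕ x) (toℕ u) (toℕ (punchIn x u))
  punchIn-view zero    u       = above z≤n
  punchIn-view (suc x) zero    = below (s≤s z≤n)
  punchIn-view (suc x) (suc u) = suc-view (punchIn-view x u)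
    where
    suc-view : {X U P : ℕ} → PunchedIn X U P → PunchedIn (suc X) (suc U) (suc P)
    suc-view (below u<x) = below (s≤s u<x)
    suc-view (above x≤u) = above (s≤s x≤u)

  module _ {X U P : ℕ} where

    punchedIn-precedes : PunchedIn X U P → suc P ≡ X ⇔ suc U ≡ X
    punchedIn-precedes (below _)   = ⇔-id _
    punchedIn-precedes (above x≤u) = mk⇔
      (λ { refl → contradiction (≤-trans (n≤1+n _) x≤u) 1+n≰n })
      (λ { refl → contradiction x≤u 1+n≰n })

    punchedIn-precedes₂ : {W Q : ℕ} → PunchedIn X U P → PunchedIn X W Q →
                          suc P ≡ Q ⇔ (suc U ≡ W × W ≢ X)
    punchedIn-precedes₂ (below u<x) (below w<x) = mk⇔
      (λ 1+u≡w → 1+u≡w , λ w≡x → <-irrefl w≡x w<x)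
      (λ (1+u≡w , _) → 1+u≡w)
    punchedIn-precedes₂ (below u<x) (above x≤w) = mk⇔
      (λ 1+u≡1+w → contradiction (suc-injective 1+u≡1+w) (<⇒≢ (<-≤-trans u<x x≤w)))
      (λ { (refl , w≢x) → contradiction (≤-antisym x≤w u<x) (w≢x ∘ sym) })
    punchedIn-precedes₂ (above x≤u) (below w<x) = mk⇔
      (λ { refl → contradiction (≤-trans (n≤1+n _) (n≤1+n _)) (<⇒≱ (<-≤-trans w<x x≤u)) })
      (λ { (refl , _) → contradiction (n≤1+n _) (<⇒≱ (<-≤-trans w<x x≤u)) })
    punchedIn-precedes₂ (above x≤u) (above x≤w) = mk⇔
      (λ 2+u≡1+w → let 1+u≡w = suc-injective 2+u≡1+w in
        1+u≡w , λ w≡x → 1+n≰n (subst (_≤ U) (trans (sym w≡x) (sym 1+u≡w)) x≤u))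
      (λ (1+u≡w , _) → cong suc 1+u≡w)

  module _ {k : ℕ} (π : Vec (Fin k) k) (x : Fin (suc k)) where

    private
      σ = prepend π x
      D? = invDescent? π
      X? = λ b → toℕ (lookup π b) ≟ toℕ x

      punchIn-view-prepend : ∀ a → PunchedIn (toℕ x) (toℕ (lookup π a)) (toℕ (lookup σ (suc a)))
      punchIn-view-prepend a =
        subst (PunchedIn _ _ ∘ toℕ) (sym (lookup-prepend π x a)) (punchIn-view x (lookup π a))

      invDescent-prepend₀ : ∀ a → InvDescent σ (suc a) zero ⇔ suc (toℕ (lookup π a)) ≡ toℕ x
      invDescent-prepend₀ a = mk⇔ (λ (_ , e) → to e) (λ e → s≤s z≤n , from e)
        where open Equivalence (punchedIn-precedes (punchIn-view-prepend a))

      invDescent-prepend : ∀ a b →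
        InvDescent σ (suc a) (suc b) ⇔ (InvDescent π a b × toℕ (lookup π b) ≢ toℕ x)
      invDescent-prepend a b = mk⇔
        (λ { (s≤s b<a , e) → let (e′ , b≢x) = to e in (b<a , e′) , b≢x })
        (λ ((b<a , e′) , b≢x) → s≤s b<a , from (e′ , b≢x))
        where open Equivalence (punchedIn-precedes₂ (punchIn-view-prepend a) (punchIn-view-prepend b))

    ides-prepend : ides (prepend π x) + idesAt π x ≡ ∑[ a < k ] ⟦ suc (toℕ (lookup π a)) ≟ toℕ x ⟧ + ides π
    ides-prepend = begin
      ides σ + idesAt π x
        ≡⟨ cong (_+ idesAt π x) (∑∑-dropRow₀ (λ a b → ⟦ invDescent? σ a b ⟧) row₀) ⟩
      ∑[ a < k ] ⟦ invDescent? σ (suc a) zero ⟧ + ∑[ a < k ] ∑[ b < k ] ⟦ invDescent? σ (suc a) (suc b) ⟧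
        + idesAt π x
        ≡⟨ cong₂ (λ u v → u + v + idesAt π x)
                 (sum-cong-≗ column₀) (sum-cong-≗ (λ a → sum-cong-≗ (inner a))) ⟩
      C + ∑[ a < k ] ∑[ b < k ] ⟦ D? a b ×-dec ¬? (X? b) ⟧ + ∑[ a < k ] ∑[ b < k ] ⟦ D? a b ×-dec X? b ⟧
        ≡⟨ +-assoc C _ _ ⟩
      C + (∑[ a < k ] ∑[ b < k ] ⟦ D? a b ×-dec ¬? (X? b) ⟧ + ∑[ a < k ] ∑[ b < k ] ⟦ D? a b ×-dec X? b ⟧)
        ≡⟨ cong (C +_) (∑∑-distrib-+ (λ a b → ⟦ D? a b ×-dec ¬? (X? b) ⟧)
                                      (λ a b → ⟦ D? a b ×-dec X? b ⟧)) ⟨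
      C + ∑[ a < k ] ∑[ b < k ] (⟦ D? a b ×-dec ¬? (X? b) ⟧ + ⟦ D? a b ×-dec X? b ⟧)
        ≡⟨ cong (C +_) (sum-cong-≗ (λ a → sum-cong-≗ (λ b → ⟦⟧-split (D? a b) (X? b)))) ⟩
      C + ides π
        ∎
      where
      open ≡-Reasoning
      C = ∑[ a < k ] ⟦ suc (toℕ (lookup π a)) ≟ toℕ x ⟧
      row₀ : ∀ b → ⟦ invDescent? σ zero b ⟧ ≡ 0
      row₀ b = ⟦⟧-no (invDescent? σ zero b) (λ { (() , _) })
      column₀ : ∀ a → ⟦ invDescent? σ (suc a) zero ⟧ ≡ ⟦ suc (toℕ (lookup π a)) ≟ toℕ x ⟧
      column₀ a =
        ⟦⟧-cong (invDescent? σ (suc a) zero) (suc (toℕ (lookup π a)) ≟ toℕ x) (invDescent-prepend₀ a)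
      inner : ∀ a b → ⟦ invDescent? σ (suc a) (suc b) ⟧ ≡ ⟦ D? a b ×-dec ¬? (X? b) ⟧
      inner a b = ⟦⟧-cong (invDescent? σ (suc a) (suc b)) (D? a b ×-dec ¬? (X? b)) (invDescent-prepend a b)

  module _ {k : ℕ} (π : Vec (Fin k) k) where

    idesAt-zero : idesAt π zero ≡ 0
    idesAt-zero = trans (sum-cong-≗ (λ a → trans (sum-cong-≗ (none a)) (sum-replicate-zero k))) (sum-replicate-zero k)
      where
      none : ∀ a b → ⟦ invDescent? π a b ×-dec (toℕ (lookup π b) ≟ 0) ⟧ ≡ 0
      none a b = ⟦⟧-no (invDescent? π a b ×-dec (toℕ (lookup π b) ≟ 0))
        (λ { ((_ , 1+πa≡πb) , πb≡0) → contradiction (trans 1+πa≡πb πb≡0) λ () })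

    idesAt≤1 : IsPerm π → ∀ x → idesAt π x ≤ 1
    idesAt≤1 π-perm x = begin
      idesAt π x
        ≤⟨ ∑-mono-≤ k (λ a → ∑-mono-≤ k (λ b → ≤-trans
             (⟦⟧-mono (D? a b) (A? a ×-dec X? b)
                      (λ ((_ , 1+πa≡πb) , πb≡x) → trans 1+πa≡πb πb≡x , πb≡x))
             (≤-reflexive (⟦⟧-× (A? a) (X? b))))) ⟩
      ∑[ a < k ] ∑[ b < k ] (⟦ A? a ⟧ * ⟦ X? b ⟧)
        ≡⟨ sum-cong-≗ (λ a → *-distribˡ-sum ⟦ A? a ⟧ (λ b → ⟦ X? b ⟧)) ⟨
      ∑[ a < k ] (⟦ A? a ⟧ * ∑[ b < k ] ⟦ X? b ⟧)
        ≡⟨ *-distribʳ-sum (∑[ b < k ] ⟦ X? b ⟧) (λ a → ⟦ A? a ⟧) ⟨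
      ∑[ a < k ] ⟦ A? a ⟧ * ∑[ b < k ] ⟦ X? b ⟧
        ≤⟨ *-mono-≤ (∑-atMostOne A? (λ e e′ → π-perm _ _ (toℕ-injective (suc-injective (trans e (sym e′))))))
                    (∑-atMostOne X? (λ e e′ → π-perm _ _ (toℕ-injective (trans e (sym e′))))) ⟩
      1
        ∎
      where
      open ≤-Reasoning
      D? = λ a b → invDescent? π a b ×-dec (toℕ (lookup π b) ≟ toℕ x)
      A? = λ a → suc (toℕ (lookup π a)) ≟ toℕ x
      X? = λ b → toℕ (lookup π b) ≟ toℕ x

    ∑-idesAt : ∑[ x < suc k ] idesAt π x ≡ ides π
    ∑-idesAt = begin
      ∑[ x < suc k ] ∑[ a < k ] ∑[ b < k ] ⟦ D? a b ×-dec X? b x ⟧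
        ≡⟨ ∑-comm (λ x a → ∑[ b < k ] ⟦ D? a b ×-dec X? b x ⟧) ⟩
      ∑[ a < k ] ∑[ x < suc k ] ∑[ b < k ] ⟦ D? a b ×-dec X? b x ⟧
        ≡⟨ sum-cong-≗ (λ a → ∑-comm (λ x b → ⟦ D? a b ×-dec X? b x ⟧)) ⟩
      ∑[ a < k ] ∑[ b < k ] ∑[ x < suc k ] ⟦ D? a b ×-dec X? b x ⟧
        ≡⟨ sum-cong-≗ (λ a → sum-cong-≗ (λ b → trans (sum-cong-≗ (λ x → ⟦⟧-× (D? a b) (X? b x)))
                                                    (sym (*-distribˡ-sum ⟦ D? a b ⟧ (λ x → ⟦ X? b x ⟧))))) ⟩
      ∑[ a < k ] ∑[ b < k ] (⟦ D? a b ⟧ * ∑[ x < suc k ] ⟦ X? b x ⟧)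
        ≡⟨ sum-cong-≗ (λ a → sum-cong-≗ (λ b →
             trans (cong (⟦ D? a b ⟧ *_) (∑-X? b)) (*-identityʳ _))) ⟩
      ides π
        ∎
      where
      open ≡-Reasoning
      D? = invDescent? π
      X? = λ b (x : Fin (suc k)) → toℕ (lookup π b) ≟ toℕ x
      ∑-X? : ∀ b → ∑[ x < suc k ] ⟦ X? b x ⟧ ≡ 1
      ∑-X? b = ∑-unique (X? b) (λ e e′ → toℕ-injective (trans (sym e) e′))
                        (sym (toℕ-inject₁ (lookup π b)))

  module _ {k : ℕ} (π : Vec (Fin k) k) (π-perm : IsPerm π) where

    private
      S = ides π

      -- ides (prepend π x) = 1 + ides π - ε x: putting x in front creates the inverse descent of
      -- the values x - 1, x unless x = 0, and destroys the inverse descent with larger value x.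
      ε : Fin (suc k) → ℕ
      ε zero    = 1
      ε (suc y) = idesAt π (suc y)

      ε≤1 : ∀ x → ε x ≤ 1
      ε≤1 zero    = ≤-refl
      ε≤1 (suc y) = idesAt≤1 π π-perm (suc y)

      ∑ε : ∑[ x < suc k ] ε x ≡ suc S
      ∑ε = cong suc (trans (cong (_+ ∑[ y < k ] idesAt π (suc y)) (sym (idesAt-zero π))) (∑-idesAt π))

      ides-prepend+ε : ∀ x → suc (ides (prepend π x)) + ε x ≡ suc (suc S)
      ides-prepend+ε zero = trans (+-comm (suc (ides (prepend π zero))) 1) (cong (λ n → suc (suc n)) (begin
        ides (prepend π zero)                  ≡⟨ +-identityʳ _ ⟨
        ides (prepend π zero) + 0              ≡⟨ cong (ides (prepend π zero) +_) (idesAt-zero π) ⟨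
        ides (prepend π zero) + idesAt π zero  ≡⟨ ides-prepend π zero ⟩
        ∑[ a < k ] 0 + S                       ≡⟨ cong (_+ S) (sum-replicate-zero k) ⟩
        S                                      ∎))
        where open ≡-Reasoning
      ides-prepend+ε (suc y) =
        cong suc (trans (ides-prepend π (suc y)) (cong (_+ S) (∑-⟦lookup≟⟧ π π-perm y)))

    prepend-recurrence : (i : ℕ) →
      ∑[ x < suc k ] ⟦ suc (ides (prepend π x)) ≟ suc i ⟧ + i * ⟦ suc (ides π) ≟ i ⟧ ≡
      suc i * ⟦ suc (ides π) ≟ suc i ⟧ + suc k * ⟦ suc (ides π) ≟ i ⟧
    prepend-recurrence i = begin
      C + i * ⟦ suc S ≟ i ⟧
        ≡⟨ cong (C +_) (trans (*-comm i _) (sym (⟦≟⟧-* (suc S) i))) ⟩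
      C + ⟦ suc S ≟ i ⟧ * suc S
        ≡⟨ cong (λ e → C + ⟦ suc S ≟ i ⟧ * e) ∑ε ⟨
      C + ⟦ suc S ≟ i ⟧ * ∑[ x < suc k ] ε x
        ≡⟨ ∑-levelSets (λ x → suc (ides (prepend π x))) ε (suc S) (suc i) ε≤1 ides-prepend+ε ⟩
      ⟦ suc S ≟ suc i ⟧ * ∑[ x < suc k ] ε x + ⟦ suc S ≟ i ⟧ * suc k
        ≡⟨ cong (λ e → ⟦ suc S ≟ suc i ⟧ * e + ⟦ suc S ≟ i ⟧ * suc k) ∑ε ⟩
      ⟦ suc S ≟ suc i ⟧ * suc S + ⟦ suc S ≟ i ⟧ * suc k
        ≡⟨ cong₂ _+_ (trans (⟦≟⟧-* (suc S) (suc i)) (*-comm ⟦ suc S ≟ suc i ⟧ (suc i)))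
                     (*-comm ⟦ suc S ≟ i ⟧ (suc k)) ⟩
      suc i * ⟦ suc S ≟ suc i ⟧ + suc k * ⟦ suc S ≟ i ⟧
        ∎
      where
      open ≡-Reasoning
      C = ∑[ x < suc k ] ⟦ suc (ides (prepend π x)) ≟ suc i ⟧

  -- eulerian k j counts the π ∈ S_k with ides π = j - 1: the coefficient of x^j in x·A_k(x).
  eulerian : ℕ → ℕ → ℕ
  eulerian k j = length (filter (λ π → suc (ides π) ≟ j) (perms k))

  eulerian≡∑ : (k j : ℕ) → eulerian k j ≡ ∑[ π ∈ perms k ] ⟦ suc (ides π) ≟ j ⟧
  eulerian≡∑ k j = length-filter≡∑ (λ π → suc (ides π) ≟ j) (perms k)

  eulerian-zero : (k : ℕ) → eulerian k 0 ≡ 0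
  eulerian-zero k = cong length (filter-none (λ π → suc (ides π) ≟ 0) {xs = perms k} (All.tabulate (λ _ ())))

  -- The Eulerian recurrence ⟨k+1, i⟩ = (i+1)⟨k, i⟩ + (k+1-i)⟨k, i-1⟩, shifted and free of subtraction.
  eulerian-recurrence : (k i : ℕ) →
    eulerian (suc k) (suc i) + i * eulerian k i ≡ suc i * eulerian k (suc i) + suc k * eulerian k i
  eulerian-recurrence k i = begin
    eulerian (suc k) (suc i) + i * eulerian k i
      ≡⟨ cong₂ _+_ (count-perms-suc (prepend-isPermBijection {k}) (λ σ → suc (ides σ) ≟ suc i))
                   (trans (cong (i *_) (eulerian≡∑ k i)) (*-distribˡ-∑ₗ i (perms k) _)) ⟩
    ∑[ π ∈ perms k ] C π + ∑[ π ∈ perms k ] (i * ⟦ T π ≟ i ⟧)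
      ≡⟨ ∑ₗ-distrib-+ (perms k) C (λ π → i * ⟦ T π ≟ i ⟧) ⟨
    ∑[ π ∈ perms k ] (C π + i * ⟦ T π ≟ i ⟧)
      ≡⟨ ∑ₗ-cong (perms k) (λ {π} π∈perms → prepend-recurrence π (∈-perms⁻ π∈perms) i) ⟩
    ∑[ π ∈ perms k ] (suc i * ⟦ T π ≟ suc i ⟧ + suc k * ⟦ T π ≟ i ⟧)
      ≡⟨ ∑ₗ-distrib-+ (perms k) (λ π → suc i * ⟦ T π ≟ suc i ⟧) (λ π → suc k * ⟦ T π ≟ i ⟧) ⟩
    ∑[ π ∈ perms k ] (suc i * ⟦ T π ≟ suc i ⟧) + ∑[ π ∈ perms k ] (suc k * ⟦ T π ≟ i ⟧)
      ≡⟨ cong₂ _+_ (trans (cong (suc i *_) (eulerian≡∑ k (suc i))) (*-distribˡ-∑ₗ (suc i) (perms k) _))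
                   (trans (cong (suc k *_) (eulerian≡∑ k i)) (*-distribˡ-∑ₗ (suc k) (perms k) _)) ⟨
    suc i * eulerian k (suc i) + suc k * eulerian k i
      ∎
    where
    open ≡-Reasoning
    T : Vec (Fin k) k → ℕ
    T π = suc (ides π)
    C : Vec (Fin k) k → ℕ
    C π = ∑[ x < suc k ] ⟦ suc (ides (prepend π x)) ≟ suc i ⟧

  odp-count : (k j : ℕ) →
    length (filter (λ σ → outdeg σ ≟ j) (perms (suc (suc k)))) ≡ suc (suc k) * eulerian (suc k) j
  odp-count k j = begin
    length (filter (λ σ → outdeg σ ≟ j) (perms (suc (suc k))))
      ≡⟨ count-perms-suc rotated-isPermBijection (λ σ → outdeg σ ≟ j) ⟩
    ∑[ π ∈ perms (suc k) ] ∑[ r < suc (suc k) ] ⟦ outdeg (rotated π r) ≟ j ⟧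
      ≡⟨ ∑ₗ-cong (perms (suc k)) (λ {π} π∈perms → ∑-rotated π (∈-perms⁻ π∈perms)) ⟩
    ∑[ π ∈ perms (suc k) ] (suc (suc k) * ⟦ suc (ides π) ≟ j ⟧)
      ≡⟨ trans (cong (suc (suc k) *_) (eulerian≡∑ (suc k) j)) (*-distribˡ-∑ₗ (suc (suc k)) (perms (suc k)) _) ⟨
    suc (suc k) * eulerian (suc k) j
      ∎
    where
    open ≡-Reasoning
    open Rotation {suc k}
    ∑-rotated : (π : Vec (Fin (suc k)) (suc k)) → IsPerm π →
                ∑[ r < suc (suc k) ] ⟦ outdeg (rotated π r) ≟ j ⟧ ≡ suc (suc k) * ⟦ suc (ides π) ≟ j ⟧
    ∑-rotated π π-perm = trans
      (sum-cong-≗ (λ r → cong (λ d → ⟦ d ≟ j ⟧)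
        (trans (outdeg-rotated π r) (outdeg-prepend-zero-isPerm π π-perm))))
      (∑-const (suc (suc k)) ⟦ suc (ides π) ≟ j ⟧)

module PowerSeries where

  open import Data.Nat using (ℕ; zero; suc; _∸_; _^_)
  import Data.Nat as ℕ
  import Data.Nat.Properties as ℕ
  open import Data.Integer using (ℤ; +_; _+_; _*_; _-_)
  open import Data.Integer.Properties using (pos-+; pos-*; +-assoc; +-identityʳ; *-identityˡ)
  open import Data.Integer.Tactic.RingSolver using (solve-∀)
  open import Function using (_∘_)
  open import Relation.Binary.PropositionalEquality
    using (_≡_; _≗_; refl; sym; trans; cong; cong₂; module ≡-Reasoning)
  open Combinatorics using (eulerian; eulerian-zero; eulerian-recurrence; odp-count)

  -- Formal power series and finite differences

  sumTo-cong : (m : ℕ) {f g : ℕ → ℤ} → f ≗ g → sumTo m f ≡ sumTo m g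
  sumTo-cong zero    f≗g = f≗g 0
  sumTo-cong (suc m) f≗g = cong₂ _+_ (sumTo-cong m f≗g) (f≗g (suc m))

  sumTo-suc : (m : ℕ) (f : ℕ → ℤ) → sumTo (suc m) f ≡ f 0 + sumTo m (f ∘ suc)
  sumTo-suc zero    f = refl
  sumTo-suc (suc m) f = trans (cong (_+ f (suc (suc m))) (sumTo-suc m f)) (+-assoc (f 0) _ _)

  sumTo-zero : (m : ℕ) → sumTo m (λ _ → + 0) ≡ + 0
  sumTo-zero zero    = refl
  sumTo-zero (suc m) = cong (_+ + 0) (sumTo-zero m)

  sumTo-- : (m : ℕ) (f g : ℕ → ℤ) → sumTo m (λ i → f i - g i) ≡ sumTo m f - sumTo m g
  sumTo-- zero    f g = refl
  sumTo-- (suc m) f g = trans (cong (_+ (f (suc m) - g (suc m))) (sumTo-- m f g))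
                              (lemma (sumTo m f) (sumTo m g) (f (suc m)) (g (suc m)))
    where
    lemma : ∀ a b c d → a - b + (c - d) ≡ a + c - (b + d)
    lemma = solve-∀

  Δ : Series → Series
  Δ g zero    = g zero
  Δ g (suc m) = g (suc m) - g m

  shift : Series → Series
  shift g zero    = + 0
  shift g (suc m) = g m

  Δⁿ : ℕ → Series → Series
  Δⁿ zero    g = g
  Δⁿ (suc n) g = Δ (Δⁿ n g)

  Δ-cong : {f g : Series} → f ≗ g → Δ f ≗ Δ g
  Δ-cong f≗g zero    = f≗g 0
  Δ-cong f≗g (suc m) = cong₂ _-_ (f≗g (suc m)) (f≗g m)

  Δⁿ-cong : (n : ℕ) {f g : Series} → f ≗ g → Δⁿ n f ≗ Δⁿ n g
  Δⁿ-cong zero    f≗g = f≗g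
  Δⁿ-cong (suc n) f≗g = Δ-cong (Δⁿ-cong n f≗g)

  shift-cong : {f g : Series} → f ≗ g → shift f ≗ shift g
  shift-cong f≗g zero    = refl
  shift-cong f≗g (suc m) = f≗g m

  ⊛-congˡ : {f g : Series} → f ≗ g → (r : Series) → f ⊛ r ≗ g ⊛ r
  ⊛-congˡ f≗g r m = sumTo-cong m (λ i → cong (_* r (m ∸ i)) (f≗g i))

  oneS-⊛ : (g : Series) → oneS ⊛ g ≗ g
  oneS-⊛ g zero    = *-identityˡ (g 0)
  oneS-⊛ g (suc m) = begin
    sumTo (suc m) (λ i → oneS i * g (suc m ∸ i))
      ≡⟨ sumTo-suc m _ ⟩
    + 1 * g (suc m) + sumTo m (λ i → + 0 * g (m ∸ i))
      ≡⟨ cong₂ _+_ (*-identityˡ (g (suc m))) (sumTo-zero m) ⟩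
    g (suc m) + + 0
      ≡⟨ +-identityʳ (g (suc m)) ⟩
    g (suc m)
      ∎
    where open ≡-Reasoning

  Δ-⊛ : (h r : Series) → Δ h ⊛ r ≗ Δ (h ⊛ r)
  Δ-⊛ h r zero    = refl
  Δ-⊛ h r (suc m) = begin
    sumTo (suc m) (λ i → Δ h i * r (suc m ∸ i))
      ≡⟨ sumTo-suc m _ ⟩
    h 0 * r (suc m) + sumTo m (λ i → (h (suc i) - h i) * r (m ∸ i))
      ≡⟨ cong (_+_ (h 0 * r (suc m))) (trans (sumTo-cong m (λ i → distrib (h (suc i)) (h i) (r (m ∸ i))))
                                            (sumTo-- m (λ i → h (suc i) * r (m ∸ i)) (λ i → h i * r (m ∸ i)))) ⟩
    h 0 * r (suc m) + (sumTo m (λ i → h (suc i) * r (m ∸ i)) - (h ⊛ r) m)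
      ≡⟨ assoc (h 0 * r (suc m)) _ _ ⟩
    h 0 * r (suc m) + sumTo m (λ i → h (suc i) * r (m ∸ i)) - (h ⊛ r) m
      ≡⟨ cong (_- (h ⊛ r) m) (sumTo-suc m (λ i → h i * r (suc m ∸ i))) ⟨
    (h ⊛ r) (suc m) - (h ⊛ r) m
      ∎
    where
    open ≡-Reasoning
    distrib : ∀ a b c → (a - b) * c ≡ a * c - b * c
    distrib = solve-∀
    assoc : ∀ a b c → a + (b - c) ≡ a + b - c
    assoc = solve-∀

  oneMinusX≗Δ-oneS : oneMinusX ≗ Δ oneS
  oneMinusX≗Δ-oneS zero          = refl
  oneMinusX≗Δ-oneS (suc zero)    = refl
  oneMinusX≗Δ-oneS (suc (suc m)) = refl

  oneMinusX^-⊛ : (n : ℕ) (r : Series) → (oneMinusX ^S n) ⊛ r ≗ Δⁿ n r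
  oneMinusX^-⊛ zero    r m = oneS-⊛ r m
  oneMinusX^-⊛ (suc n) r m = begin
    ((oneMinusX ⊛ P) ⊛ r) m  ≡⟨ ⊛-congˡ (λ i → trans (⊛-congˡ oneMinusX≗Δ-oneS P i) (Δ-⊛ oneS P i)) r m ⟩
    (Δ (oneS ⊛ P) ⊛ r) m     ≡⟨ ⊛-congˡ (Δ-cong (oneS-⊛ P)) r m ⟩
    (Δ P ⊛ r) m              ≡⟨ Δ-⊛ P r m ⟩
    Δ (P ⊛ r) m              ≡⟨ Δ-cong (oneMinusX^-⊛ n r) m ⟩
    Δⁿ (suc n) r m           ∎
    where
    open ≡-Reasoning
    P = oneMinusX ^S n

  Δ-+ : (f g : Series) → Δ (λ t → f t + g t) ≗ λ m → Δ f m + Δ g m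
  Δ-+ f g zero    = refl
  Δ-+ f g (suc m) = lemma (f (suc m)) (g (suc m)) (f m) (g m)
    where
    lemma : ∀ a b c d → a + b - (c + d) ≡ a - c + (b - d)
    lemma = solve-∀

  Δ-*ˡ : (c : ℤ) (f : Series) → Δ (λ t → c * f t) ≗ λ m → c * Δ f m
  Δ-*ˡ c f zero    = refl
  Δ-*ˡ c f (suc m) = lemma c (f (suc m)) (f m)
    where
    lemma : ∀ c a b → c * a - c * b ≡ c * (a - b)
    lemma = solve-∀

  Δⁿ-*ˡ : (n : ℕ) (c : ℤ) (f : Series) → Δⁿ n (λ t → c * f t) ≗ λ m → c * Δⁿ n f m
  Δⁿ-*ˡ zero    c f m = refl
  Δⁿ-*ˡ (suc n) c f m = trans (Δ-cong (Δⁿ-*ˡ n c f) m) (Δ-*ˡ c (Δⁿ n f) m)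

  Δ-shift : (g : Series) → Δ (shift g) ≗ shift (Δ g)
  Δ-shift g zero          = refl
  Δ-shift g (suc zero)    = lemma (g 0)
    where
    lemma : ∀ a → a - + 0 ≡ a
    lemma = solve-∀
  Δ-shift g (suc (suc m)) = refl

  Δ-leibniz : (g : Series) → Δ (λ t → + t * g t) ≗ λ m → + m * Δ g m + shift g m
  Δ-leibniz g zero    = lemma (g 0)
    where
    lemma : ∀ a → + 0 * a ≡ + 0 * a + + 0
    lemma = solve-∀
  Δ-leibniz g (suc m) = lemma (+ m) (g (suc m)) (g m)
    where
    lemma : ∀ t a b → (+ 1 + t) * a - t * b ≡ (+ 1 + t) * (a - b) + b
    lemma = solve-∀

  Δⁿ-leibniz : (n : ℕ) (g : Series) →
    Δⁿ (suc n) (λ t → + t * g t) ≗ λ m → + m * Δⁿ (suc n) g m + + suc n * shift (Δⁿ n g) m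
  Δⁿ-leibniz zero    g m = trans (Δ-leibniz g m) (cong (_+_ (+ m * Δ g m)) (sym (*-identityˡ (shift g m))))
  Δⁿ-leibniz (suc n) g m = begin
    Δ (Δⁿ (suc n) (λ t → + t * g t)) m
      ≡⟨ Δ-cong (Δⁿ-leibniz n g) m ⟩
    Δ (λ t → + t * Δⁿ (suc n) g t + + suc n * shift (Δⁿ n g) t) m
      ≡⟨ Δ-+ (λ t → + t * Δⁿ (suc n) g t) (λ t → + suc n * shift (Δⁿ n g) t) m ⟩
    Δ (λ t → + t * Δⁿ (suc n) g t) m + Δ (λ t → + suc n * shift (Δⁿ n g) t) m
      ≡⟨ cong₂ _+_ (Δ-leibniz (Δⁿ (suc n) g) m)
                   (trans (Δ-*ˡ (+ suc n) (shift (Δⁿ n g)) m) (cong (+ suc n *_) (Δ-shift (Δⁿ n g) m))) ⟩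
    + m * Δⁿ (suc (suc n)) g m + shift (Δⁿ (suc n) g) m + + suc n * shift (Δⁿ (suc n) g) m
      ≡⟨ lemma (+ m * Δⁿ (suc (suc n)) g m) (shift (Δⁿ (suc n) g) m) (+ n) ⟩
    + m * Δⁿ (suc (suc n)) g m + + suc (suc n) * shift (Δⁿ (suc n) g) m
      ∎
    where
    open ≡-Reasoning
    lemma : ∀ a b n → a + b + (+ 1 + n) * b ≡ a + (+ 2 + n) * b
    lemma = solve-∀

  pow : ℕ → Series
  pow k t = + (t ^ k)

  oneMinusX^-⊛-rhsSeries : (n : ℕ) → (oneMinusX ^S n) ⊛ rhsSeries n ≗ λ m → + n * Δⁿ n (pow (n ∸ 1)) m
  oneMinusX^-⊛-rhsSeries n m = trans (oneMinusX^-⊛ n (rhsSeries n) m)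
    (trans (Δⁿ-cong n (λ t → pos-* n (t ^ (n ∸ 1))) m) (Δⁿ-*ˡ n (+ n) (pow (n ∸ 1)) m))

  -- Both sides obey the Eulerian recurrence

  eulerianStep : ℕ → Series → Series
  eulerianStep k f m = + m * Δ f m + + suc (suc k) * shift f m

  eulerianStep-cong : (k : ℕ) {f g : Series} → f ≗ g → eulerianStep k f ≗ eulerianStep k g
  eulerianStep-cong k f≗g m = cong₂ (λ a b → + m * a + + suc (suc k) * b) (Δ-cong f≗g m) (shift-cong f≗g m)

  Δⁿ-pow-eulerianStep : (k : ℕ) → Δⁿ (suc (suc k)) (pow (suc k)) ≗ eulerianStep k (Δⁿ (suc k) (pow k))
  Δⁿ-pow-eulerianStep k m =
    trans (Δⁿ-cong (suc (suc k)) (λ t → pos-* t (t ^ k)) m) (Δⁿ-leibniz (suc k) (pow k) m)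

  recurrence-in-ℤ : {x a b : ℕ} (i k : ℕ) → x ℕ.+ i ℕ.* b ≡ suc i ℕ.* a ℕ.+ suc k ℕ.* b →
                    + x ≡ + suc i * (+ a - + b) + + suc (suc k) * + b
  recurrence-in-ℤ {x} {a} {b} i k rec = begin
    + x                                          ≡⟨ cancel (+ x) (+ i) (+ b) ⟩
    + x + + i * + b - + i * + b                  ≡⟨ cong (_- + i * + b) recℤ ⟩
    + suc i * + a + + suc k * + b - + i * + b    ≡⟨ rearrange (+ i) (+ a) (+ b) (+ k) ⟩
    + suc i * (+ a - + b) + + suc (suc k) * + b  ∎
    where
    open ≡-Reasoning
    cancel : ∀ x i b → x ≡ x + i * b - i * b
    cancel = solve-∀
    rearrange : ∀ i a b k → (+ 1 + i) * a + (+ 1 + k) * b - i * b ≡ (+ 1 + i) * (a - b) + (+ 2 + k) * b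
    rearrange = solve-∀
    recℤ : + x + + i * + b ≡ + suc i * + a + + suc k * + b
    recℤ = begin
      + x + + i * + b                    ≡⟨ cong (_+_ (+ x)) (pos-* i b) ⟨
      + (x ℕ.+ i ℕ.* b)                  ≡⟨ cong +_ rec ⟩
      + (suc i ℕ.* a ℕ.+ suc k ℕ.* b)    ≡⟨ pos-+ (suc i ℕ.* a) (suc k ℕ.* b) ⟩
      + (suc i ℕ.* a) + + (suc k ℕ.* b)  ≡⟨ cong₂ _+_ (pos-* (suc i) a) (pos-* (suc k) b) ⟩
      + suc i * + a + + suc k * + b      ∎

  eulerian-eulerianStep : (k : ℕ) → (λ j → + eulerian (suc k) j) ≗ eulerianStep k (λ j → + eulerian k j)
  eulerian-eulerianStep k zero    = trans (cong +_ (eulerian-zero (suc k))) (vanish (+ eulerian k 0) (+ k))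
    where
    vanish : ∀ a k → + 0 ≡ + 0 * a + (+ 2 + k) * + 0
    vanish = solve-∀
  eulerian-eulerianStep k (suc i) = recurrence-in-ℤ i k (eulerian-recurrence k i)

  eulerian≗Δⁿ-pow : (k : ℕ) → (λ j → + eulerian (suc k) j) ≗ Δⁿ (suc (suc k)) (pow (suc k))
  eulerian≗Δⁿ-pow zero    zero          = refl
  eulerian≗Δⁿ-pow zero    (suc zero)    = refl
  eulerian≗Δⁿ-pow zero    (suc (suc t)) =
    sym (trans (Δⁿ-cong 2 (λ u → cong +_ (ℕ.*-identityʳ u)) (suc (suc t))) (vanish (+ t)))
    where
    vanish : ∀ t → + 1 + (+ 1 + t) - (+ 1 + t) - (+ 1 + t - t) ≡ + 0
    vanish = solve-∀
  eulerian≗Δⁿ-pow (suc k) j = begin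
    + eulerian (suc (suc k)) j
      ≡⟨ eulerian-eulerianStep (suc k) j ⟩
    eulerianStep (suc k) (λ i → + eulerian (suc k) i) j
      ≡⟨ eulerianStep-cong (suc k) (eulerian≗Δⁿ-pow k) j ⟩
    eulerianStep (suc k) (Δⁿ (suc (suc k)) (pow (suc k))) j
      ≡⟨ Δⁿ-pow-eulerianStep (suc k) j ⟨
    Δⁿ (suc (suc (suc k))) (pow (suc (suc k))) j
      ∎
    where open ≡-Reasoning

  ODP-TourCycle≗ : (k : ℕ) → ODP-TourCycle (suc k) ≗ λ m → + suc k * Δⁿ (suc k) (pow k) m
  ODP-TourCycle≗ zero    zero    = refl
  ODP-TourCycle≗ zero    (suc m) = refl
  ODP-TourCycle≗ (suc k) m = begin
    ODP-TourCycle (suc (suc k)) m                     ≡⟨ cong +_ (odp-count k m) ⟩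
    + (suc (suc k) ℕ.* eulerian (suc k) m)            ≡⟨ pos-* (suc (suc k)) (eulerian (suc k) m) ⟩
    + suc (suc k) * + eulerian (suc k) m              ≡⟨ cong (_*_ (+ suc (suc k))) (eulerian≗Δⁿ-pow k m) ⟩
    + suc (suc k) * Δⁿ (suc (suc k)) (pow (suc k)) m  ∎
    where open ≡-Reasoning

open PowerSeries using (ODP-TourCycle≗; oneMinusX^-⊛-rhsSeries)

theorem5p4 : (n : ℕ) → 1 ≤ n → (m : ℕ) →
    ODP-TourCycle n m ≡ ((oneMinusX ^S n) ⊛ rhsSeries n) m
theorem5p4 (suc k) _ m = trans (ODP-TourCycle≗ k m) (sym (oneMinusX^-⊛-rhsSeries (suc k) m))
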